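{- Let $G$ be a finite bipartite graph with color classes $A$ and $B$, and $b:V(G)\to\mathbb{Z}_{\ge0}$. If $C_1$ and $C_2$ are two distinct loose flexible components hooked up by $A$, then no edge of $G$ joins a vertex of $C_1$ to a vertex of $C_2$.
   Context: A $b$-matching is $M\subseteq E(G)$ with at most $b(v)$ edges of $M$ at each $v$; maximum = largest cardinality; $v$ is $M$-loose if fewer than $b(v)$ edges of $M$ are incident with it. An edge is allowed if in some maximum $b$-matching; an allowed edge is inevitable if in every maximum $b$-matching, flexible otherwise. Flexible components: induced subgraphs $G[V(K)]$, $K$ a connected component of $(V(G),\{\text{flexible edges}\})$. $\mathcal{D}$: vertices $M$-loose for some maximum $b$-matching $M$. A flexible component $C$ is a loose flexible component hooked up by $A$ if $V(C)\cap\mathcal{D}\cap A\ne\emptyset$. -}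

module Defs where

open import Data.Nat using (ℕ; _≤_; _<_)
open import Data.Fin using (Fin; _≟_)
open import Data.Fin.Subset using (Subset; _∈_; _∉_; _∩_; ∣_∣)
open import Data.Vec using (tabulate)
open import Data.Bool using (Bool; _∨_)
open import Data.Sum using (_⊎_; inj₁; inj₂)
open import Data.Product using (Σ; _×_; _,_; ∃)
open import Relation.Nullary using (¬_)
open import Relation.Nullary.Decidable using (⌊_⌋)
open import Relation.Binary.PropositionalEquality using (_≡_)

-- A finite bipartite graph with colour classes A = Fin p and B = Fin q,
-- and m edges; edge e joins endA e ∈ A with endB e ∈ B.
record BipGraph : Set where
  field
    p q m : ℕ
    endA  : Fin m → Fin p
    endB  : Fin m → Fin q

module _ (G : BipGraph) where
  open BipGraph G

  V : Set
  V = Fin p ⊎ Fin q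

  Simple : Set
  Simple = ∀ e f → endA e ≡ endA f → endB e ≡ endB f → e ≡ f

  isEnd : V → Fin m → Bool
  isEnd (inj₁ a) e = ⌊ endA e ≟ a ⌋
  isEnd (inj₂ b) e = ⌊ endB e ≟ b ⌋

  incident : V → Subset m
  incident v = tabulate (isEnd v)

  deg : Subset m → V → ℕ
  deg M v = ∣ M ∩ incident v ∣

  module _ (b : V → ℕ) where

    IsBMatching : Subset m → Set
    IsBMatching M = ∀ v → deg M v ≤ b v

    IsMaxBMatching : Subset m → Set
    IsMaxBMatching M = IsBMatching M × (∀ M′ → IsBMatching M′ → ∣ M′ ∣ ≤ ∣ M ∣)

    Loose : Subset m → V → Set
    Loose M v = deg M v < b v

    Allowed : Fin m → Set
    Allowed e = Σ (Subset m) λ M → IsMaxBMatching M × e ∈ M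

    Inevitable : Fin m → Set
    Inevitable e = Allowed e × (∀ M → IsMaxBMatching M → e ∈ M)

    Flexible : Fin m → Set
    Flexible e = Allowed e × ¬ Inevitable e

    InD : V → Set
    InD v = Σ (Subset m) λ M → IsMaxBMatching M × Loose M v

    -- connectivity in the spanning subgraph (V(G), flexible edges):
    -- u and w lie in the same flexible component
    data FlexReach : V → V → Set where
      here  : ∀ {v} → FlexReach v v
      stepAB : ∀ {u w} e → Flexible e → FlexReach u (inj₁ (endA e)) →
               w ≡ inj₂ (endB e) → FlexReach u w
      stepBA : ∀ {u w} e → Flexible e → FlexReach u (inj₂ (endB e)) →
               w ≡ inj₁ (endA e) → FlexReach u w

    -- the flexible component containing c (given by its vertex set)
    InComp : V → V → Set
    InComp c v = FlexReach c v

    LooseHookedByA : V → Set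
    LooseHookedByA c = Σ (Fin p) λ a → InComp c (inj₁ a) × InD (inj₁ a)

-- Fix a maximum b-matching M in which the A-vertex hooking up the first component is loose,
-- and let X ⊆ A and Y ⊆ B be the vertices reachable from M-loose vertices of A by
-- M-alternating trails.  Switching M along such a trail gives maximum b-matchings; hence Y is
-- saturated by M, and an edge from X to Y whose B-end has b > 0 can be put into and taken out
-- of maximum b-matchings, i.e. it is flexible.  The size of any b-matching is bounded by the
-- b-capacity of the cover (A ∖ X) ∪ Y plus the number of edges from X to B ∖ Y, and M attains
-- this bound.  So every maximum b-matching saturates A ∖ X, contains every edge from X to B ∖ Y
-- and no edge from A ∖ X to Y: flexible edges never leave X ∪ Y, and 𝒟 ∩ A ⊆ X.  Both hooked
-- components therefore lie in X ∪ Y, and an edge between them would be flexible.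
module Submission where

open import Defs
open import Algebra.Properties.CommutativeSemigroup using (xy∙z≈zy∙x; x∙yz≈yx∙z)
open import Data.Bool using (Bool; true; false; not; _∧_)
open import Data.Fin using (Fin; zero; suc; _≟_; punchIn)
open import Data.Fin.Properties using (punchInᵢ≢i; ∀-cons)
open import Data.Fin.Subset using (Subset; ∣_∣; _∩_)
open import Data.List using (List; []; _∷_)
open import Data.List.Membership.Propositional using (_∈_; _∉_)
open import Data.List.Relation.Unary.Any using (here; there)
open import Data.Nat using (ℕ; zero; suc; _+_; _*_; _≤_; _<_; z≤n; s≤s; _<?_)
open import Data.Nat.Properties hiding (_≟_)
open import Data.Product using (∃; ∃₂; _×_; _,_; proj₁; proj₂)
open import Data.Sum using (inj₁; inj₂; [_,_])
open import Data.Vec using ([]; _∷_; lookup; _[_]≔_)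
open import Data.Vec.Properties
  using (lookup∘tabulate; lookup∘update; lookup∘update′; []=⇒lookup; lookup⇒[]=)
open import Function using (_∘_)
open import Relation.Nullary using (¬_; Dec; yes; no; contradiction)
open import Relation.Nullary.Decidable
  using (⌊_⌋; isYes≗does; dec-true; dec-false; ¬¬-excluded-middle)
open import Relation.Binary.PropositionalEquality
  using (_≡_; _≢_; refl; sym; trans; cong; cong₂; subst; subst₂; module ≡-Reasoning)
open import Algebra.Properties.Semiring.Sum +-*-semiring
  using (sum; sum-syntax; sum-cong-≗; sum-remove; sum-replicate-zero; ∑-comm; ∑-distrib-+;
         *-distribˡ-sum)

⟦_⟧ : Bool → ℕ
⟦ true ⟧ = 1
⟦ false ⟧ = 0

+-mono-≤-tight : ∀ {a b c d} → a ≤ c → b ≤ d → c + d ≤ a + b → a ≡ c × b ≡ d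
+-mono-≤-tight {a} {b} {c} {d} a≤c b≤d c+d≤a+b =
  ≤-antisym a≤c (+-cancelʳ-≤ d c a (≤-trans c+d≤a+b (+-monoʳ-≤ a b≤d))) ,
  ≤-antisym b≤d (+-cancelˡ-≤ c d b (≤-trans c+d≤a+b (+-monoˡ-≤ b a≤c)))

⌊⌋-true : ∀ {A : Set} (a? : Dec A) → A → ⌊ a? ⌋ ≡ true
⌊⌋-true a? a = trans (isYes≗does a?) (dec-true a? a)

⌊⌋-false : ∀ {A : Set} (a? : Dec A) → ¬ A → ⌊ a? ⌋ ≡ false
⌊⌋-false a? ¬a = trans (isYes≗does a?) (dec-false a? ¬a)

⌊⌋≡true⇒ : ∀ {A : Set} (a? : Dec A) → ⌊ a? ⌋ ≡ true → A
⌊⌋≡true⇒ (yes a) _ = a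

⌊⌋≡false⇒¬ : ∀ {A : Set} (a? : Dec A) → ⌊ a? ⌋ ≡ false → ¬ A
⌊⌋≡false⇒¬ (no ¬a) _ = ¬a

⟦⟧*-cancel : ∀ {x k l} → x ≡ true → ⟦ x ⟧ * k ≡ ⟦ x ⟧ * l → k ≡ l
⟦⟧*-cancel {k = k} {l} refl eq = trans (sym (+-identityʳ k)) (trans eq (+-identityʳ l))

¬¬-decidable : ∀ {n} (P : Fin n → Set) → ¬ ¬ (∀ i → Dec (P i))
¬¬-decidable {zero}  P k = k λ ()
¬¬-decidable {suc n} P k =
  ¬¬-excluded-middle λ P₀? → ¬¬-decidable (P ∘ suc) λ P₊? → k (∀-cons P₀? P₊?)

sum-mono-≤ : ∀ {n} {f g : Fin n → ℕ} → (∀ i → f i ≤ g i) → sum f ≤ sum g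
sum-mono-≤ {zero}  _   = z≤n
sum-mono-≤ {suc n} f≤g = +-mono-≤ (f≤g zero) (sum-mono-≤ (f≤g ∘ suc))

sum-mono-≤-tight : ∀ {n} {f g : Fin n → ℕ} → (∀ i → f i ≤ g i) → sum g ≤ sum f → ∀ i → f i ≡ g i
sum-mono-≤-tight {suc n} {f} {g} f≤g Σg≤Σf =
  ∀-cons (proj₁ split) (sum-mono-≤-tight (f≤g ∘ suc) (≤-reflexive (sym (proj₂ split))))
  where
  split : f zero ≡ g zero × sum (f ∘ suc) ≡ sum (g ∘ suc)
  split = +-mono-≤-tight (f≤g zero) (sum-mono-≤ (f≤g ∘ suc)) Σg≤Σf

sum-positive : ∀ {n} {f : Fin n → ℕ} → 0 < sum f → ∃ λ i → 0 < f i
sum-positive {suc n} {f} 0<Σf with 0 <? f zero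
... | yes 0<f₀ = zero , 0<f₀
... | no  0≮f₀ with sum-positive {f = f ∘ suc} (<-≤-trans 0<Σf (+-monoˡ-≤ _ (≮⇒≥ 0≮f₀)))
...   | i , 0<fᵢ = suc i , 0<fᵢ

sum-update : ∀ {n} {f g : Fin n → ℕ} (i : Fin n) → (∀ j → j ≢ i → f j ≡ g j) →
             sum f + g i ≡ sum g + f i
sum-update {suc n} {f} {g} i f≡g = begin
  sum f + g i                           ≡⟨ cong (_+ g i) (sum-remove {i = i} f) ⟩
  f i + sum (f ∘ punchIn i) + g i       ≡⟨ cong (λ s → f i + s + g i)
                                                 (sum-cong-≗ λ j → f≡g _ (punchInᵢ≢i i j)) ⟩
  f i + sum (g ∘ punchIn i) + g i       ≡⟨ xy∙z≈zy∙x +-commutativeSemigroup (f i) _ (g i) ⟩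
  g i + sum (g ∘ punchIn i) + f i       ≡⟨ cong (_+ f i) (sum-remove {i = i} g) ⟨
  sum g + f i                           ∎
  where open ≡-Reasoning

sum-indicator : ∀ {n} (h : Fin n → ℕ) (i : Fin n) → ∑[ a < n ] (h a * ⟦ ⌊ i ≟ a ⌋ ⟧) ≡ h i
sum-indicator {n} h i = begin
  ∑[ a < n ] (h a * ⟦ ⌊ i ≟ a ⌋ ⟧)           ≡⟨ +-identityʳ _ ⟨
  ∑[ a < n ] (h a * ⟦ ⌊ i ≟ a ⌋ ⟧) + 0       ≡⟨ sum-update {g = λ _ → 0} i off-i ⟩
  ∑[ a < n ] 0 + h i * ⟦ ⌊ i ≟ i ⌋ ⟧         ≡⟨ cong₂ _+_ (sum-replicate-zero n)
                                                         (cong (λ x → h i * ⟦ x ⟧) (⌊⌋-true (i ≟ i) refl)) ⟩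
  h i * 1                                   ≡⟨ *-identityʳ (h i) ⟩
  h i                                       ∎
  where
  open ≡-Reasoning
  off-i : ∀ j → j ≢ i → h j * ⟦ ⌊ i ≟ j ⌋ ⟧ ≡ 0
  off-i j j≢i = trans (cong (λ x → h j * ⟦ x ⟧) (⌊⌋-false (i ≟ j) (j≢i ∘ sym))) (*-zeroʳ (h j))

∑-fibres : ∀ {m k} (f : Fin m → Fin k) (w : Fin m → ℕ) (c : Fin k → ℕ) →
           ∑[ a < k ] (c a * ∑[ e < m ] (w e * ⟦ ⌊ f e ≟ a ⌋ ⟧)) ≡ ∑[ e < m ] (w e * c (f e))
∑-fibres {m} {k} f w c = begin
  ∑[ a < k ] (c a * ∑[ e < m ] (w e * δ e a))  ≡⟨ sum-cong-≗ (λ a → *-distribˡ-sum (c a) (λ e → w e * δ e a)) ⟩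
  ∑[ a < k ] ∑[ e < m ] (c a * (w e * δ e a)) ≡⟨ ∑-comm (λ a e → c a * (w e * δ e a)) ⟩
  ∑[ e < m ] ∑[ a < k ] (c a * (w e * δ e a)) ≡⟨ sum-cong-≗ (λ e → sum-cong-≗ λ a →
                                                   x∙yz≈yx∙z *-commutativeSemigroup (c a) (w e) (δ e a)) ⟩
  ∑[ e < m ] ∑[ a < k ] (w e * c a * δ e a)   ≡⟨ sum-cong-≗ (λ e → sum-indicator (λ a → w e * c a) (f e)) ⟩
  ∑[ e < m ] (w e * c (f e))                  ∎
  where
  open ≡-Reasoning
  δ : Fin m → Fin k → ℕ
  δ e a = ⟦ ⌊ f e ≟ a ⌋ ⟧

weight : ∀ {n} → (Fin n → ℕ) → Subset n → ℕ
weight {n} w S = ∑[ i < n ] (⟦ lookup S i ⟧ * w i)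

weight-cong : ∀ {n} {w w′ : Fin n → ℕ} (S : Subset n) → (∀ i → w i ≡ w′ i) → weight w S ≡ weight w′ S
weight-cong S w≡w′ = sum-cong-≗ λ i → cong (⟦ lookup S i ⟧ *_) (w≡w′ i)

weight-+ : ∀ {n} (w w′ : Fin n → ℕ) (S : Subset n) → weight (λ i → w i + w′ i) S ≡ weight w S + weight w′ S
weight-+ w w′ S = trans (sum-cong-≗ λ i → *-distribˡ-+ ⟦ lookup S i ⟧ (w i) (w′ i))
                        (∑-distrib-+ (λ i → ⟦ lookup S i ⟧ * w i) (λ i → ⟦ lookup S i ⟧ * w′ i))

⟦⟧*-≤ : ∀ x k → ⟦ x ⟧ * k ≤ k
⟦⟧*-≤ true  k = ≤-reflexive (*-identityˡ k)
⟦⟧*-≤ false k = z≤n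

weight≤sum : ∀ {n} (w : Fin n → ℕ) (S : Subset n) → weight w S ≤ sum w
weight≤sum w S = sum-mono-≤ λ i → ⟦⟧*-≤ (lookup S i) (w i)

weight-positive : ∀ {n} {w : Fin n → ℕ} (S : Subset n) → 0 < weight w S →
                  ∃ λ i → lookup S i ≡ true × 0 < w i
weight-positive S 0<weight with sum-positive 0<weight
... | i , 0<term with lookup S i in Sᵢ
...   | true  = i , Sᵢ , subst (0 <_) (+-identityʳ _) 0<term
...   | false = contradiction 0<term λ ()

weight-zero : ∀ {n} {w : Fin n → ℕ} (S : Subset n) → weight w S ≡ 0 → ∀ i → 0 < w i → lookup S i ≡ false
weight-zero {n} {w} S weight≡0 i 0<wᵢ with lookup S i | term≡0 i
  where
  term≡0 : ∀ j → 0 ≡ ⟦ lookup S j ⟧ * w j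
  term≡0 = sum-mono-≤-tight (λ _ → z≤n) (≤-reflexive (trans weight≡0 (sym (sum-replicate-zero n))))
... | false | _    = refl
... | true  | 0≡wᵢ = contradiction (trans 0≡wᵢ (+-identityʳ (w i))) (<⇒≢ 0<wᵢ)

∣∣≡weight : ∀ {n} (S : Subset n) → ∣ S ∣ ≡ weight (λ _ → 1) S
∣∣≡weight []          = refl
∣∣≡weight (true  ∷ S) = cong suc (∣∣≡weight S)
∣∣≡weight (false ∷ S) = ∣∣≡weight S

∣∩∣≡weight : ∀ {n} (S T : Subset n) → ∣ S ∩ T ∣ ≡ weight (λ i → ⟦ lookup T i ⟧) S
∣∩∣≡weight []          []          = refl
∣∩∣≡weight (true  ∷ S) (true  ∷ T) = cong suc (∣∩∣≡weight S T)
∣∩∣≡weight (true  ∷ S) (false ∷ T) = ∣∩∣≡weight S T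
∣∩∣≡weight (false ∷ S) (_     ∷ T) = ∣∩∣≡weight S T

weight-update : ∀ {n} (w : Fin n → ℕ) (S : Subset n) i x →
                weight w (S [ i ]≔ x) + ⟦ lookup S i ⟧ * w i ≡ weight w S + ⟦ x ⟧ * w i
weight-update w S i x =
  trans (sum-update i λ j j≢i → cong (λ y → ⟦ y ⟧ * w j) (lookup∘update′ j≢i S x))
        (cong (λ y → weight w S + ⟦ y ⟧ * w i) (lookup∘update i S x))

weight-insert : ∀ {n} (w : Fin n → ℕ) (S : Subset n) {i} → lookup S i ≡ false →
                weight w (S [ i ]≔ true) ≡ w i + weight w S
weight-insert w S {i} Sᵢ = begin
  weight w (S [ i ]≔ true)                            ≡⟨ +-identityʳ _ ⟨
  weight w (S [ i ]≔ true) + ⟦ false ⟧ * w i          ≡⟨ cong (λ x → weight w (S [ i ]≔ true) + ⟦ x ⟧ * w i) Sᵢ ⟨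
  weight w (S [ i ]≔ true) + ⟦ lookup S i ⟧ * w i     ≡⟨ weight-update w S i true ⟩
  weight w S + (w i + 0)                              ≡⟨ cong (weight w S +_) (+-identityʳ (w i)) ⟩
  weight w S + w i                                    ≡⟨ +-comm _ (w i) ⟩
  w i + weight w S                                    ∎
  where open ≡-Reasoning

weight-remove : ∀ {n} (w : Fin n → ℕ) (S : Subset n) {i} → lookup S i ≡ true →
                weight w S ≡ w i + weight w (S [ i ]≔ false)
weight-remove w S {i} Sᵢ = begin
  weight w S                                          ≡⟨ +-identityʳ _ ⟨
  weight w S + ⟦ false ⟧ * w i                        ≡⟨ weight-update w S i false ⟨
  weight w (S [ i ]≔ false) + ⟦ lookup S i ⟧ * w i    ≡⟨ cong (λ x → weight w (S [ i ]≔ false) + ⟦ x ⟧ * w i) Sᵢ ⟩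
  weight w (S [ i ]≔ false) + (w i + 0)               ≡⟨ cong (weight w (S [ i ]≔ false) +_) (+-identityʳ (w i)) ⟩
  weight w (S [ i ]≔ false) + w i                     ≡⟨ +-comm _ (w i) ⟩
  w i + weight w (S [ i ]≔ false)                     ∎
  where open ≡-Reasoning

exchange : ∀ {n} → Subset n → Fin n → Fin n → Subset n
exchange S h g = S [ h ]≔ false [ g ]≔ true

module _ {n} (S : Subset n) {g h : Fin n} (Sg : lookup S g ≡ false) (Sh : lookup S h ≡ true) where

  private
    g≢h : g ≢ h
    g≢h refl = contradiction (trans (sym Sg) Sh) λ ()

  weight-exchange : ∀ w → weight w (exchange S h g) + w h ≡ w g + weight w S
  weight-exchange w = begin
    weight w (exchange S h g) + w h             ≡⟨ cong (_+ w h) (weight-insert w (S [ h ]≔ false)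
                                                                    (trans (lookup∘update′ g≢h S false) Sg)) ⟩
    w g + weight w (S [ h ]≔ false) + w h       ≡⟨ +-assoc (w g) _ (w h) ⟩
    w g + (weight w (S [ h ]≔ false) + w h)     ≡⟨ cong (w g +_) (+-comm _ (w h)) ⟩
    w g + (w h + weight w (S [ h ]≔ false))     ≡⟨ cong (w g +_) (weight-remove w S Sh) ⟨
    w g + weight w S                            ∎
    where open ≡-Reasoning

  lookup-exchange-new : lookup (exchange S h g) g ≡ true
  lookup-exchange-new = lookup∘update g (S [ h ]≔ false) true

  lookup-exchange-old : lookup (exchange S h g) h ≡ false
  lookup-exchange-old = trans (lookup∘update′ (g≢h ∘ sym) (S [ h ]≔ false) true) (lookup∘update h S false)

  lookup-exchange-other : ∀ {e} → e ≢ g → e ≢ h → lookup (exchange S h g) e ≡ lookup S e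
  lookup-exchange-other e≢g e≢h =
    trans (lookup∘update′ e≢g (S [ h ]≔ false) true) (lookup∘update′ e≢h S false)

module _ (G : BipGraph) where
  open BipGraph G

  incidence : V G → Fin m → ℕ
  incidence v e = ⟦ isEnd G v e ⟧

  incidence-endA : ∀ e → incidence (inj₁ (endA e)) e ≡ 1
  incidence-endA e = cong ⟦_⟧ (⌊⌋-true (endA e ≟ endA e) refl)

  incidence-endB : ∀ e → incidence (inj₂ (endB e)) e ≡ 1
  incidence-endB e = cong ⟦_⟧ (⌊⌋-true (endB e ≟ endB e) refl)

  incidence-≢A : ∀ {a e} → endA e ≢ a → incidence (inj₁ a) e ≡ 0
  incidence-≢A {a} {e} endA≢a = cong ⟦_⟧ (⌊⌋-false (endA e ≟ a) endA≢a)

  incidence-≢B : ∀ {y e} → endB e ≢ y → incidence (inj₂ y) e ≡ 0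
  incidence-≢B {y} {e} endB≢y = cong ⟦_⟧ (⌊⌋-false (endB e ≟ y) endB≢y)

  deg≡weight : ∀ S v → deg G S v ≡ weight (incidence v) S
  deg≡weight S v = trans (∣∩∣≡weight S (incident G v))
                         (weight-cong S λ e → cong ⟦_⟧ (lookup∘tabulate (isEnd G v) e))

  ∑-deg-A : ∀ (c : Fin p → ℕ) S → ∑[ a < p ] (c a * deg G S (inj₁ a)) ≡ weight (c ∘ endA) S
  ∑-deg-A c S = trans (sum-cong-≗ λ a → cong (c a *_) (deg≡weight S (inj₁ a)))
                      (∑-fibres endA (λ e → ⟦ lookup S e ⟧) c)

  ∑-deg-B : ∀ (c : Fin q → ℕ) S → ∑[ y < q ] (c y * deg G S (inj₂ y)) ≡ weight (c ∘ endB) S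
  ∑-deg-B c S = trans (sum-cong-≗ λ y → cong (c y *_) (deg≡weight S (inj₂ y)))
                      (∑-fibres endB (λ e → ⟦ lookup S e ⟧) c)

  deg-positive : ∀ {S e} → lookup S e ≡ true → 0 < deg G S (inj₂ (endB e))
  deg-positive {S} {e} Sₑ =
    subst (0 <_) (sym (trans (deg≡weight S (inj₂ (endB e))) (weight-remove _ S Sₑ)))
          (≤-trans (≤-reflexive (sym (incidence-endB e))) (m≤m+n _ _))

  matched-edge-at : ∀ {S y} → 0 < deg G S (inj₂ y) → ∃ λ f → lookup S f ≡ true × endB f ≡ y
  matched-edge-at {S} {y} 0<deg with weight-positive S (subst (0 <_) (deg≡weight S (inj₂ y)) 0<deg)
  ... | f , S_f , 0<incidence = f , S_f , endB-at 0<incidence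
    where
    endB-at : 0 < incidence (inj₂ y) f → endB f ≡ y
    endB-at 0<i with endB f ≟ y
    ... | yes endB≡y = endB≡y
    ... | no  _      = contradiction 0<i λ ()

  module _ (S : Subset m) {g} (Sg : lookup S g ≡ false) where

    deg-insert : ∀ v → deg G (S [ g ]≔ true) v ≡ incidence v g + deg G S v
    deg-insert v = trans (deg≡weight (S [ g ]≔ true) v)
                         (trans (weight-insert _ S Sg) (cong (incidence v g +_) (sym (deg≡weight S v))))

    ∣∣-insert : ∣ S [ g ]≔ true ∣ ≡ suc ∣ S ∣
    ∣∣-insert = trans (∣∣≡weight (S [ g ]≔ true))
                      (trans (weight-insert _ S Sg) (cong suc (sym (∣∣≡weight S))))

    module _ {h} (Sh : lookup S h ≡ true) where

      deg-exchange : ∀ v → deg G (exchange S h g) v + incidence v h ≡ incidence v g + deg G S v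
      deg-exchange v = begin
        deg G (exchange S h g) v + incidence v h
          ≡⟨ cong (_+ incidence v h) (deg≡weight (exchange S h g) v) ⟩
        weight (incidence v) (exchange S h g) + incidence v h
          ≡⟨ weight-exchange S Sg Sh (incidence v) ⟩
        incidence v g + weight (incidence v) S
          ≡⟨ cong (incidence v g +_) (deg≡weight S v) ⟨
        incidence v g + deg G S v
          ∎
        where open ≡-Reasoning

      ∣∣-exchange : ∣ exchange S h g ∣ ≡ ∣ S ∣
      ∣∣-exchange = +-cancelʳ-≡ 1 _ _ (begin
        ∣ exchange S h g ∣ + 1                    ≡⟨ cong (_+ 1) (∣∣≡weight (exchange S h g)) ⟩
        weight (λ _ → 1) (exchange S h g) + 1     ≡⟨ weight-exchange S Sg Sh (λ _ → 1) ⟩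
        suc (weight (λ _ → 1) S)                  ≡⟨ cong suc (∣∣≡weight S) ⟨
        suc ∣ S ∣                                 ≡⟨ +-comm 1 _ ⟩
        ∣ S ∣ + 1                                 ∎)
        where open ≡-Reasoning

      deg-exchange-B : endB h ≡ endB g → ∀ y → deg G (exchange S h g) (inj₂ y) ≡ deg G S (inj₂ y)
      deg-exchange-B h~g y = +-cancelʳ-≡ (incidence (inj₂ y) g) _ _ (begin
        deg G (exchange S h g) (inj₂ y) + incidence (inj₂ y) g
          ≡⟨ cong (λ z → deg G (exchange S h g) (inj₂ y) + ⟦ ⌊ z ≟ y ⌋ ⟧) h~g ⟨
        deg G (exchange S h g) (inj₂ y) + incidence (inj₂ y) h
          ≡⟨ deg-exchange (inj₂ y) ⟩
        incidence (inj₂ y) g + deg G S (inj₂ y)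
          ≡⟨ +-comm (incidence (inj₂ y) g) _ ⟩
        deg G S (inj₂ y) + incidence (inj₂ y) g
          ∎)
        where open ≡-Reasoning

module _ (G : BipGraph) (b : V G → ℕ) where
  open BipGraph G

  IsBMatching-≤-insert : ∀ S S′ {g} → IsBMatching G b S → Loose G b S (inj₁ (endA g)) →
                     (∀ v → deg G S′ v ≤ incidence G v g + deg G S v) →
                     deg G S′ (inj₂ (endB g)) ≤ b (inj₂ (endB g)) → IsBMatching G b S′
  IsBMatching-≤-insert S S′ {g} bS looseA step atB = bounded
    where
    away-from-g : ∀ v → incidence G v g ≡ 0 → deg G S′ v ≤ b v
    away-from-g v g∌v = ≤-trans (step v) (subst (λ k → k + deg G S v ≤ b v) (sym g∌v) (bS v))
    bounded : IsBMatching G b S′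
    bounded (inj₁ a) with endA g ≟ a
    ... | yes refl   = ≤-trans (step (inj₁ (endA g)))
                               (subst (λ k → k + deg G S (inj₁ (endA g)) ≤ b (inj₁ (endA g)))
                                      (sym (incidence-endA G g)) looseA)
    ... | no endA≢a = away-from-g (inj₁ a) (incidence-≢A G endA≢a)
    bounded (inj₂ y) with endB g ≟ y
    ... | yes refl   = atB
    ... | no endB≢y = away-from-g (inj₂ y) (incidence-≢B G endB≢y)

  module _ (S : Subset m) {g} (bS : IsBMatching G b S) (Sg : lookup S g ≡ false)
           (looseA : Loose G b S (inj₁ (endA g))) where

    insert-IsBMatching : Loose G b S (inj₂ (endB g)) → IsBMatching G b (S [ g ]≔ true)
    insert-IsBMatching looseB =
      IsBMatching-≤-insert S (S [ g ]≔ true) bS looseA (λ v → ≤-reflexive (deg-insert G S Sg v))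
        (subst (_≤ b y) (sym (trans (deg-insert G S Sg y) (cong (_+ deg G S y) (incidence-endB G g)))) looseB)
      where
      y : V G
      y = inj₂ (endB g)

    module _ {h} (Sh : lookup S h ≡ true) where

      exchange-IsBMatching : endB h ≡ endB g → IsBMatching G b (exchange S h g)
      exchange-IsBMatching h~g = IsBMatching-≤-insert S (exchange S h g) bS looseA
        (λ v → subst (deg G (exchange S h g) v ≤_) (deg-exchange G S Sg Sh v) (m≤m+n _ _))
        (subst (_≤ b (inj₂ (endB g))) (sym (deg-exchange-B G S Sg Sh h~g (endB g))) (bS (inj₂ (endB g))))

      exchange-Loose : Loose G b (exchange S h g) (inj₁ (endA h))
      exchange-Loose = subst (_≤ b a) (sym suc-deg′) (bound (endA g ≟ endA h))
        where
        a : V G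
        a = inj₁ (endA h)
        suc-deg′ : suc (deg G (exchange S h g) a) ≡ incidence G a g + deg G S a
        suc-deg′ = trans (+-comm 1 _) (trans (cong (deg G (exchange S h g) a +_) (sym (incidence-endA G h)))
                                             (deg-exchange G S Sg Sh a))
        bound : Dec (endA g ≡ endA h) → incidence G a g + deg G S a ≤ b a
        bound (yes g~h) = subst (λ x → incidence G (inj₁ x) g + deg G S (inj₁ x) ≤ b (inj₁ x)) g~h
                                (subst (λ k → k + deg G S (inj₁ (endA g)) ≤ b (inj₁ (endA g)))
                                       (sym (incidence-endA G g)) looseA)
        bound (no g≁h)  = subst (λ k → k + deg G S a ≤ b a) (sym (incidence-≢A G g≁h)) (bS a)

  IsMaxBMatching-sameSize : ∀ M → IsMaxBMatching G b M → ∀ N → IsBMatching G b N → ∣ N ∣ ≡ ∣ M ∣ →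
                            IsMaxBMatching G b N
  IsMaxBMatching-sameSize M maxM N bN ∣N∣≡∣M∣ =
    bN , λ N′ bN′ → subst (∣ N′ ∣ ≤_) (sym ∣N∣≡∣M∣) (proj₂ maxM N′ bN′)

  module _ (M : Subset m) (maxM : IsMaxBMatching G b M)
           (N : Subset m) (bN : IsBMatching G b N) (∣N∣≡∣M∣ : ∣ N ∣ ≡ ∣ M ∣) where

    no-augmenting-edge : ∀ {g} → lookup N g ≡ false → Loose G b N (inj₁ (endA g)) →
                         ¬ Loose G b N (inj₂ (endB g))
    no-augmenting-edge Ng looseA looseB = 1+n≰n
      (subst (_≤ ∣ M ∣) (trans (∣∣-insert G N Ng) (cong suc ∣N∣≡∣M∣))
             (proj₂ maxM (N [ _ ]≔ true) (insert-IsBMatching N bN Ng looseA looseB)))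

    exchange-in : ∀ {e} → lookup N e ≡ false → Loose G b N (inj₁ (endA e)) → 0 < deg G N (inj₂ (endB e)) →
                  ∃ λ N′ → IsMaxBMatching G b N′ × lookup N′ e ≡ true
    exchange-in {e} Ne looseA 0<deg with matched-edge-at G {S = N} 0<deg
    ... | f , Nf , f~e =
      exchange N f e ,
      IsMaxBMatching-sameSize M maxM (exchange N f e) (exchange-IsBMatching N bN Ne looseA Nf f~e)
                              (trans (∣∣-exchange G N Ne Nf) ∣N∣≡∣M∣) ,
      lookup-exchange-new N Ne Nf

  flexible-by : ∀ {e} → (∃ λ N → IsMaxBMatching G b N × lookup N e ≡ true) →
                (∃ λ N → IsMaxBMatching G b N × lookup N e ≡ false) → Flexible G b e
  flexible-by {e} (N₁ , maxN₁ , N₁e) (N₂ , maxN₂ , N₂e) =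
    (N₁ , maxN₁ , lookup⇒[]= e N₁ N₁e) ,
    λ (_ , inevitable) → contradiction (trans (sym ([]=⇒lookup (inevitable N₂ maxN₂))) N₂e) λ ()

  allowed⇒0<b : ∀ {e} → Allowed G b e → 0 < b (inj₂ (endB e))
  allowed⇒0<b (N , (bN , _) , e∈N) = ≤-trans (deg-positive G {S = N} ([]=⇒lookup e∈N)) (bN _)

  FlexReach-trans : ∀ {u v w} → FlexReach G b u v → FlexReach G b v w → FlexReach G b u w
  FlexReach-trans p here                 = p
  FlexReach-trans p (stepAB e fl q w≡) = stepAB e fl (FlexReach-trans p q) w≡
  FlexReach-trans p (stepBA e fl q w≡) = stepBA e fl (FlexReach-trans p q) w≡

  FlexReach-sym : ∀ {u w} → FlexReach G b u w → FlexReach G b w u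
  FlexReach-sym here                  = here
  FlexReach-sym (stepAB e fl q refl) = FlexReach-trans (stepBA e fl here refl) (FlexReach-sym q)
  FlexReach-sym (stepBA e fl q refl) = FlexReach-trans (stepAB e fl here refl) (FlexReach-sym q)

  FlexReach⇒0<b : ∀ {a y} → FlexReach G b (inj₁ a) (inj₂ y) → 0 < b (inj₂ y)
  FlexReach⇒0<b (stepAB f (allowed , _) _ refl) = allowed⇒0<b allowed

module AlternatingTrails (G : BipGraph) (b : V G → ℕ) (M : Subset (BipGraph.m G)) where
  open BipGraph G
  open import Data.List.Membership.DecPropositional {A = Fin m} _≟_ using (_∈?_)

  -- Only the edges of a trail are distinct; switching M along it still changes degrees at
  -- its two ends only.
  data ATrail : Fin p → List (Fin m) → Set
  data BTrail : Fin q → List (Fin m) → Set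

  data ATrail where
    start   : ∀ {a} → Loose G b M (inj₁ a) → ATrail a []
    matched : ∀ {y es} → BTrail y es → (h : Fin m) → endB h ≡ y → lookup M h ≡ true → h ∉ es →
              ATrail (endA h) (h ∷ es)

  data BTrail where
    unmatched : ∀ {x es} → ATrail x es → (g : Fin m) → endA g ≡ x → lookup M g ≡ false → g ∉ es →
                BTrail (endB g) (g ∷ es)

  Reachable : V G → Set
  Reachable (inj₁ a) = ∃ (ATrail a)
  Reachable (inj₂ y) = ∃ (BTrail y)

  ATrail-edge-ends : ∀ {x es e} → ATrail x es → e ∈ es →
                     Reachable (inj₁ (endA e)) × Reachable (inj₂ (endB e))
  BTrail-edge-ends : ∀ {y es e} → BTrail y es → e ∈ es →
                     Reachable (inj₁ (endA e)) × Reachable (inj₂ (endB e))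
  ATrail-edge-ends P@(matched Q _ refl _ _) (here refl) = (_ , P) , (_ , Q)
  ATrail-edge-ends (matched Q _ _ _ _)      (there e∈) = BTrail-edge-ends Q e∈
  BTrail-edge-ends Q@(unmatched P _ refl _ _) (here refl) = (_ , P) , (_ , Q)
  BTrail-edge-ends (unmatched P _ _ _ _)      (there e∈) = ATrail-edge-ends P e∈

  Reachable-unmatched : ∀ {g} → Reachable (inj₁ (endA g)) → lookup M g ≡ false →
                        Reachable (inj₂ (endB g))
  Reachable-unmatched {g} (es , P) Mg with g ∈? es
  ... | yes g∈es = proj₂ (ATrail-edge-ends P g∈es)
  ... | no  g∉es = _ , unmatched P g refl Mg g∉es

  Reachable-matched : ∀ {h} → Reachable (inj₂ (endB h)) → lookup M h ≡ true →
                      Reachable (inj₁ (endA h))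
  Reachable-matched {h} (es , Q) Mh with h ∈? es
  ... | yes h∈es = proj₁ (BTrail-edge-ends Q h∈es)
  ... | no  h∉es = _ , matched Q h refl Mh h∉es

  matched-edge-on-ATrail : ∀ {e} → lookup M e ≡ true → Reachable (inj₂ (endB e)) →
                          ∃₂ λ x es → ATrail x es × e ∈ es
  matched-edge-on-ATrail {e} Me (es , Q) with e ∈? es
  ... | yes e∈es = through Q e∈es
    where
    through : ∀ {y es} → BTrail y es → e ∈ es → ∃₂ λ x es → ATrail x es × e ∈ es
    through (unmatched _ _ _ Mg _) (here refl) = contradiction (trans (sym Mg) Me) λ ()
    through (unmatched P _ _ _ _)  (there e∈) = _ , _ , P , e∈
  ... | no  e∉es = _ , _ , matched Q e refl Me e∉es , here refl

  record Switched (x : Fin p) (es : List (Fin m)) : Set where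
    field
      N           : Subset m
      isBMatching : IsBMatching G b N
      size        : ∣ N ∣ ≡ ∣ M ∣
      loose       : Loose G b N (inj₁ x)
      deg-B       : ∀ y → deg G N (inj₂ y) ≡ deg G M (inj₂ y)
      off-trail   : ∀ {e} → e ∉ es → lookup N e ≡ lookup M e
      on-trail    : ∀ {e} → e ∈ es → lookup N e ≡ not (lookup M e)

  switch : IsBMatching G b M → ∀ {x es} → ATrail x es → Switched x es
  switch bM (start looseM) = record
    { N = M ; isBMatching = bM ; size = refl ; loose = looseM
    ; deg-B = λ _ → refl ; off-trail = λ _ → refl ; on-trail = λ () }
  switch bM (matched (unmatched P g refl Mg g∉) h h~g Mh h∉) = record
    { N           = exchange N h g
    ; isBMatching = exchange-IsBMatching G b N isBMatching Ng loose Nh h~g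
    ; size        = trans (∣∣-exchange G N Ng Nh) size
    ; loose       = exchange-Loose G b N isBMatching Ng loose Nh
    ; deg-B       = λ y → trans (deg-exchange-B G N Ng Nh h~g y) (deg-B y)
    ; off-trail   = λ e∉ → trans (lookup-exchange-other N Ng Nh (e∉ ∘ there ∘ here) (e∉ ∘ here))
                                 (off-trail (e∉ ∘ there ∘ there))
    ; on-trail    = on-new-trail }
    where
    open Switched (switch bM P)
    Ng : lookup N g ≡ false
    Ng = trans (off-trail g∉) Mg
    Nh : lookup N h ≡ true
    Nh = trans (off-trail (h∉ ∘ there)) Mh
    on-new-trail : ∀ {e} → e ∈ h ∷ g ∷ _ → lookup (exchange N h g) e ≡ not (lookup M e)
    on-new-trail (here refl)         = trans (lookup-exchange-old N Ng Nh) (cong not (sym Mh))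
    on-new-trail (there (here refl)) = trans (lookup-exchange-new N Ng Nh) (cong not (sym Mg))
    on-new-trail (there (there e∈))  =
      trans (lookup-exchange-other N Ng Nh (λ { refl → g∉ e∈ }) (λ { refl → h∉ (there e∈) }))
            (on-trail e∈)

  module _ (maxM : IsMaxBMatching G b M) where

    BTrail-saturated : ∀ {y es} → BTrail y es → ¬ Loose G b M (inj₂ y)
    BTrail-saturated (unmatched P g refl Mg g∉) looseM =
      no-augmenting-edge G b M maxM N isBMatching size (trans (off-trail g∉) Mg) loose
                         (subst (_< b (inj₂ (endB g))) (sym (deg-B (endB g))) looseM)
      where open Switched (switch (proj₁ maxM) P)

    switch-toggles : ∀ {x es e} → ATrail x es → e ∈ es →
                     ∃ λ N → IsMaxBMatching G b N × lookup N e ≡ not (lookup M e)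
    switch-toggles P e∈ = N , IsMaxBMatching-sameSize G b M maxM N isBMatching size , on-trail e∈
      where open Switched (switch (proj₁ maxM) P)

    matched-edge-avoidable : ∀ {e} → lookup M e ≡ true → Reachable (inj₂ (endB e)) →
                             ∃ λ N → IsMaxBMatching G b N × lookup N e ≡ false
    matched-edge-avoidable Me rB with matched-edge-on-ATrail Me rB
    ... | _ , _ , P , e∈ with switch-toggles P e∈
    ...   | N , maxN , Ne = N , maxN , trans Ne (cong not Me)

    unmatched-edge-includable : ∀ {e} → lookup M e ≡ false → Reachable (inj₁ (endA e)) →
                                Reachable (inj₂ (endB e)) → 0 < b (inj₂ (endB e)) →
                                ∃ λ N → IsMaxBMatching G b N × lookup N e ≡ true
    unmatched-edge-includable {e} Me (es , P) (_ , Q) 0<b with e ∈? es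
    ... | yes e∈es with switch-toggles P e∈es
    ...   | N , maxN , Ne = N , maxN , trans Ne (cong not Me)
    unmatched-edge-includable {e} Me (es , P) (_ , Q) 0<b | no e∉es =
      exchange-in G b M maxM N isBMatching size (trans (off-trail e∉es) Me) loose
        (<-≤-trans 0<b (subst (b (inj₂ (endB e)) ≤_) (sym (deg-B (endB e))) (≮⇒≥ (BTrail-saturated Q))))
      where open Switched (switch (proj₁ maxM) P)

    reachable-edge-flexible : ∀ {e} → Reachable (inj₁ (endA e)) → Reachable (inj₂ (endB e)) →
                              0 < b (inj₂ (endB e)) → Flexible G b e
    reachable-edge-flexible {e} rA rB 0<b with lookup M e in Me
    ... | true  = flexible-by G b (M , maxM , Me) (matched-edge-avoidable Me rB)
    ... | false = flexible-by G b (unmatched-edge-includable Me rA rB 0<b) (M , maxM , Me)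

module VertexCover (G : BipGraph) (b : V G → ℕ)
                   (X : Fin (BipGraph.p G) → Bool) (Y : Fin (BipGraph.q G) → Bool) where
  open BipGraph G

  crossing backward : Fin m → ℕ
  crossing e = ⟦ X (endA e) ∧ not (Y (endB e)) ⟧
  backward e = ⟦ not (X (endA e)) ∧ Y (endB e) ⟧

  loadA loadB : Subset m → ℕ
  loadA S = ∑[ a < p ] (⟦ not (X a) ⟧ * deg G S (inj₁ a))
  loadB S = ∑[ y < q ] (⟦ Y y ⟧ * deg G S (inj₂ y))

  capacityA capacityB : ℕ
  capacityA = ∑[ a < p ] (⟦ not (X a) ⟧ * b (inj₁ a))
  capacityB = ∑[ y < q ] (⟦ Y y ⟧ * b (inj₂ y))

  load : Subset m → ℕ
  load S = loadA S + loadB S + weight crossing S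

  capacity : ℕ
  capacity = capacityA + capacityB + sum crossing

  -- (A ∖ X) ∪ Y together with the crossing edges covers every edge once, and every backward
  -- edge twice.
  size+backward≡load : ∀ S → ∣ S ∣ + weight backward S ≡ load S
  size+backward≡load S = begin
    ∣ S ∣ + weight backward S                          ≡⟨ cong (_+ weight backward S) (∣∣≡weight S) ⟩
    weight (λ _ → 1) S + weight backward S             ≡⟨ weight-+ (λ _ → 1) backward S ⟨
    weight (λ e → 1 + backward e) S                    ≡⟨ weight-cong S (λ e → cover (X (endA e)) (Y (endB e))) ⟩
    weight (λ e → notX e + Yˢ e + crossing e) S        ≡⟨ weight-+ (λ e → notX e + Yˢ e) crossing S ⟩
    weight (λ e → notX e + Yˢ e) S + weight crossing S ≡⟨ cong (_+ weight crossing S) (weight-+ notX Yˢ S) ⟩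
    weight notX S + weight Yˢ S + weight crossing S    ≡⟨ cong₂ (λ s t → s + t + weight crossing S)
                                                                (∑-deg-A G (⟦_⟧ ∘ not ∘ X) S)
                                                                (∑-deg-B G (⟦_⟧ ∘ Y) S) ⟨
    load S                                             ∎
    where
    open ≡-Reasoning
    notX Yˢ : Fin m → ℕ
    notX e = ⟦ not (X (endA e)) ⟧
    Yˢ e = ⟦ Y (endB e) ⟧
    cover : ∀ x y → 1 + ⟦ not x ∧ y ⟧ ≡ ⟦ not x ⟧ + ⟦ y ⟧ + ⟦ x ∧ not y ⟧
    cover true  true  = refl
    cover true  false = refl
    cover false true  = refl
    cover false false = refl

  load≤capacity : ∀ S → IsBMatching G b S → load S ≤ capacity
  load≤capacity S bS =
    +-mono-≤ (+-mono-≤ (sum-mono-≤ λ a → *-monoʳ-≤ ⟦ not (X a) ⟧ (bS (inj₁ a)))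
                       (sum-mono-≤ λ y → *-monoʳ-≤ ⟦ Y y ⟧ (bS (inj₂ y))))
             (weight≤sum crossing S)

  capacity≤size : ∀ S → (∀ a → X a ≡ false → b (inj₁ a) ≤ deg G S (inj₁ a)) →
                  (∀ y → Y y ≡ true → b (inj₂ y) ≤ deg G S (inj₂ y)) →
                  (∀ e → X (endA e) ≡ true → Y (endB e) ≡ false → lookup S e ≡ true) →
                  (∀ e → X (endA e) ≡ false → Y (endB e) ≡ true → lookup S e ≡ false) →
                  capacity ≤ ∣ S ∣
  capacity≤size S saturatedA saturatedB crossing-in backward-out = begin
    capacity                     ≤⟨ +-mono-≤ (+-mono-≤ (sum-mono-≤ termA) (sum-mono-≤ termB))
                                             (sum-mono-≤ λ e → term-crossing (lookup S e) (X (endA e)) (Y (endB e))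
                                                                             (crossing-in e)) ⟩
    load S                       ≡⟨ size+backward≡load S ⟨
    ∣ S ∣ + weight backward S    ≡⟨ cong (∣ S ∣ +_) no-backward ⟩
    ∣ S ∣ + 0                    ≡⟨ +-identityʳ ∣ S ∣ ⟩
    ∣ S ∣                        ∎
    where
    open ≤-Reasoning
    termA : ∀ a → ⟦ not (X a) ⟧ * b (inj₁ a) ≤ ⟦ not (X a) ⟧ * deg G S (inj₁ a)
    termA a with X a in Xa
    ... | true  = z≤n
    ... | false = *-monoʳ-≤ 1 (saturatedA a Xa)
    termB : ∀ y → ⟦ Y y ⟧ * b (inj₂ y) ≤ ⟦ Y y ⟧ * deg G S (inj₂ y)
    termB y with Y y in Yy
    ... | true  = *-monoʳ-≤ 1 (saturatedB y Yy)
    ... | false = z≤n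
    term-crossing : ∀ s x y → (x ≡ true → y ≡ false → s ≡ true) →
                    ⟦ x ∧ not y ⟧ ≤ ⟦ s ⟧ * ⟦ x ∧ not y ⟧
    term-crossing s true  false s≡ rewrite s≡ refl refl = ≤-refl
    term-crossing s true  true  _ = z≤n
    term-crossing s false _     _ = z≤n
    term-backward : ∀ s x y → (x ≡ false → y ≡ true → s ≡ false) →
                    ⟦ s ⟧ * ⟦ not x ∧ y ⟧ ≡ 0
    term-backward s false true  s≡ rewrite s≡ refl refl = refl
    term-backward s false false _ = *-zeroʳ ⟦ s ⟧
    term-backward s true  _     _ = *-zeroʳ ⟦ s ⟧
    no-backward : weight backward S ≡ 0
    no-backward = trans (sum-cong-≗ λ e → term-backward (lookup S e) (X (endA e)) (Y (endB e))
                                                        (backward-out e))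
                        (sum-replicate-zero m)

  module _ (S : Subset m) (bS : IsBMatching G b S) (capacity≤∣S∣ : capacity ≤ ∣ S ∣) where

    private
      termA≤ : ∀ a → ⟦ not (X a) ⟧ * deg G S (inj₁ a) ≤ ⟦ not (X a) ⟧ * b (inj₁ a)
      termA≤ a = *-monoʳ-≤ ⟦ not (X a) ⟧ (bS (inj₁ a))

      termB≤ : ∀ y → ⟦ Y y ⟧ * deg G S (inj₂ y) ≤ ⟦ Y y ⟧ * b (inj₂ y)
      termB≤ y = *-monoʳ-≤ ⟦ Y y ⟧ (bS (inj₂ y))

      size+backward≤size : ∣ S ∣ + weight backward S ≤ ∣ S ∣ + 0
      size+backward≤size = begin
        ∣ S ∣ + weight backward S   ≡⟨ size+backward≡load S ⟩
        load S                      ≤⟨ load≤capacity S bS ⟩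
        capacity                    ≤⟨ capacity≤∣S∣ ⟩
        ∣ S ∣                       ≡⟨ +-identityʳ ∣ S ∣ ⟨
        ∣ S ∣ + 0                   ∎
        where open ≤-Reasoning

      capacity≤load : capacity ≤ load S
      capacity≤load =
        ≤-trans capacity≤∣S∣ (≤-trans (m≤m+n ∣ S ∣ _) (≤-reflexive (size+backward≡load S)))

      tight-AB×crossing : loadA S + loadB S ≡ capacityA + capacityB × weight crossing S ≡ sum crossing
      tight-AB×crossing = +-mono-≤-tight (+-mono-≤ (sum-mono-≤ termA≤) (sum-mono-≤ termB≤))
                                         (weight≤sum crossing S) capacity≤load

      tight-A : loadA S ≡ capacityA
      tight-A = proj₁ (+-mono-≤-tight (sum-mono-≤ termA≤) (sum-mono-≤ termB≤)
                                      (≤-reflexive (sym (proj₁ tight-AB×crossing))))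

    saturated-outside-X : ∀ a → X a ≡ false → deg G S (inj₁ a) ≡ b (inj₁ a)
    saturated-outside-X a Xa = ⟦⟧*-cancel (cong not Xa)
      (sum-mono-≤-tight termA≤ (≤-reflexive (sym tight-A)) a)

    crossing-edge-in : ∀ e → X (endA e) ≡ true → Y (endB e) ≡ false → lookup S e ≡ true
    crossing-edge-in e Xe Ye = in-S (lookup S e) Xe Ye
      (sum-mono-≤-tight (λ e → ⟦⟧*-≤ (lookup S e) (crossing e))
                        (≤-reflexive (sym (proj₂ tight-AB×crossing))) e)
      where
      in-S : ∀ s {x y} → x ≡ true → y ≡ false →
             ⟦ s ⟧ * ⟦ x ∧ not y ⟧ ≡ ⟦ x ∧ not y ⟧ → s ≡ true
      in-S true  _    _    _  = refl
      in-S false refl refl ()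

    backward-edge-out : ∀ e → X (endA e) ≡ false → Y (endB e) ≡ true → lookup S e ≡ false
    backward-edge-out e Xe Ye =
      weight-zero S (n≤0⇒n≡0 (+-cancelˡ-≤ ∣ S ∣ _ _ size+backward≤size)) e
                  (subst₂ (λ x y → 0 < ⟦ not x ∧ y ⟧) (sym Xe) (sym Ye) (s≤s z≤n))

module Main (G : BipGraph) (b : V G → ℕ) (M : Subset (BipGraph.m G)) (maxM : IsMaxBMatching G b M)
            (reachable? : ∀ v → Dec (AlternatingTrails.Reachable G b M v)) where
  open BipGraph G
  open AlternatingTrails G b M
  open VertexCover G b (λ a → ⌊ reachable? (inj₁ a) ⌋) (λ y → ⌊ reachable? (inj₂ y) ⌋)

  capacity≤∣M∣ : capacity ≤ ∣ M ∣
  capacity≤∣M∣ = capacity≤size M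
    (λ a Xa → ≮⇒≥ λ looseM → ⌊⌋≡false⇒¬ (reachable? (inj₁ a)) Xa ([] , start looseM))
    (λ y Yy → ≮⇒≥ (BTrail-saturated maxM (proj₂ (⌊⌋≡true⇒ (reachable? (inj₂ y)) Yy))))
    (λ e Xe Ye → crossing-matched (⌊⌋≡true⇒ (reachable? _) Xe) (⌊⌋≡false⇒¬ (reachable? _) Ye))
    (λ e Xe Ye → backward-unmatched (⌊⌋≡false⇒¬ (reachable? _) Xe) (⌊⌋≡true⇒ (reachable? _) Ye))
    where
    crossing-matched : ∀ {e} → Reachable (inj₁ (endA e)) → ¬ Reachable (inj₂ (endB e)) →
                       lookup M e ≡ true
    crossing-matched {e} rA ¬rB with lookup M e in Me
    ... | true  = refl
    ... | false = contradiction (Reachable-unmatched rA Me) ¬rB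
    backward-unmatched : ∀ {e} → ¬ Reachable (inj₁ (endA e)) → Reachable (inj₂ (endB e)) →
                         lookup M e ≡ false
    backward-unmatched {e} ¬rA rB with lookup M e in Me
    ... | true  = contradiction (Reachable-matched rB Me) ¬rA
    ... | false = refl

  module _ (N : Subset m) (maxN : IsMaxBMatching G b N) where

    private
      capacity≤∣N∣ : capacity ≤ ∣ N ∣
      capacity≤∣N∣ = ≤-trans capacity≤∣M∣ (proj₂ maxN M (proj₁ maxM))

    unreachable-saturated : ∀ {a} → ¬ Reachable (inj₁ a) → deg G N (inj₁ a) ≡ b (inj₁ a)
    unreachable-saturated {a} ¬r =
      saturated-outside-X N (proj₁ maxN) capacity≤∣N∣ a (⌊⌋-false (reachable? _) ¬r)

    crossing-edge-inevitable : ∀ {e} → Reachable (inj₁ (endA e)) → ¬ Reachable (inj₂ (endB e)) →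
                               lookup N e ≡ true
    crossing-edge-inevitable {e} rA ¬rB =
      crossing-edge-in N (proj₁ maxN) capacity≤∣N∣ e (⌊⌋-true (reachable? _) rA) (⌊⌋-false (reachable? _) ¬rB)

    backward-edge-excluded : ∀ {e} → ¬ Reachable (inj₁ (endA e)) → Reachable (inj₂ (endB e)) →
                             lookup N e ≡ false
    backward-edge-excluded {e} ¬rA rB =
      backward-edge-out N (proj₁ maxN) capacity≤∣N∣ e (⌊⌋-false (reachable? _) ¬rA) (⌊⌋-true (reachable? _) rB)

  InD-reachable : ∀ {a} → InD G b (inj₁ a) → Reachable (inj₁ a)
  InD-reachable {a} (N , maxN , looseN) with reachable? (inj₁ a)
  ... | yes r  = r
  ... | no  ¬r = contradiction (unreachable-saturated N maxN ¬r) (<⇒≢ looseN)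

  flexible-forward : ∀ {e} → Flexible G b e → Reachable (inj₁ (endA e)) → Reachable (inj₂ (endB e))
  flexible-forward {e} (allowed , not-inevitable) rA with reachable? (inj₂ (endB e))
  ... | yes rB  = rB
  ... | no  ¬rB = contradiction
    (allowed , λ N maxN → lookup⇒[]= e N (crossing-edge-inevitable N maxN rA ¬rB)) not-inevitable

  flexible-backward : ∀ {e} → Flexible G b e → Reachable (inj₂ (endB e)) → Reachable (inj₁ (endA e))
  flexible-backward {e} ((N , maxN , e∈N) , _) rB with reachable? (inj₁ (endA e))
  ... | yes rA  = rA
  ... | no  ¬rA = contradiction (trans (sym ([]=⇒lookup e∈N)) (backward-edge-excluded N maxN ¬rA rB)) λ ()

  FlexReach-Reachable : ∀ {u w} → FlexReach G b u w → Reachable u → Reachable w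
  FlexReach-Reachable here                  r = r
  FlexReach-Reachable (stepAB e fl p refl) r = flexible-forward fl (FlexReach-Reachable p r)
  FlexReach-Reachable (stepBA e fl p refl) r = flexible-backward fl (FlexReach-Reachable p r)

  hooked-components-nonadjacent : ∀ {c₁ c₂ a₁ e} → ¬ InComp G b c₁ c₂ →
    InComp G b c₁ (inj₁ a₁) → Loose G b M (inj₁ a₁) → LooseHookedByA G b c₂ →
    ¬ (InComp G b c₁ (inj₁ (endA e)) × InComp G b c₂ (inj₂ (endB e)))
  hooked-components-nonadjacent {e = e} c₁≁c₂ c₁a₁ looseA₁ (a₂ , c₂a₂ , a₂∈𝒟) (c₁e , c₂e) =
    c₁≁c₂ (FlexReach-trans G b (stepAB e e-flexible c₁e refl) (FlexReach-sym G b c₂e))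
    where
    a₂→endB : FlexReach G b (inj₁ a₂) (inj₂ (endB e))
    a₂→endB = FlexReach-trans G b (FlexReach-sym G b c₂a₂) c₂e
    e-flexible : Flexible G b e
    e-flexible = reachable-edge-flexible maxM
      (FlexReach-Reachable (FlexReach-trans G b (FlexReach-sym G b c₁a₁) c₁e) ([] , start looseA₁))
      (FlexReach-Reachable a₂→endB (InD-reachable a₂∈𝒟))
      (FlexReach⇒0<b G b a₂→endB)

-- Reachability by alternating trails is decidable only through a search; as the goal is a
-- negation, excluded middle for it can be assumed instead.
hooked-components-nonadjacent : (G : BipGraph) (b : V G → ℕ) {c₁ c₂ : V G} → ¬ InComp G b c₁ c₂ →
  LooseHookedByA G b c₁ → LooseHookedByA G b c₂ → (e : Fin (BipGraph.m G)) →
  ¬ (InComp G b c₁ (inj₁ (BipGraph.endA G e)) × InComp G b c₂ (inj₂ (BipGraph.endB G e)))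
hooked-components-nonadjacent G b c₁≁c₂ (a₁ , c₁a₁ , M , maxM , looseA₁) hooked₂ e c₁e×c₂e =
  ¬¬-decidable (Reachable ∘ inj₁) λ reachableA? →
  ¬¬-decidable (Reachable ∘ inj₂) λ reachableB? →
  Main.hooked-components-nonadjacent G b M maxM [ reachableA? , reachableB? ]
    c₁≁c₂ c₁a₁ looseA₁ hooked₂ c₁e×c₂e
  where open AlternatingTrails G b M using (Reachable)

mainTheorem14 : (G : BipGraph) → Simple G → (b : V G → ℕ) →
    (c₁ c₂ : V G) →
    ¬ InComp G b c₁ c₂ →
    LooseHookedByA G b c₁ → LooseHookedByA G b c₂ →
    (e : Fin (BipGraph.m G)) →
    ¬ (InComp G b c₁ (inj₁ (BipGraph.endA G e)) × InComp G b c₂ (inj₂ (BipGraph.endB G e)))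
    × ¬ (InComp G b c₂ (inj₁ (BipGraph.endA G e)) × InComp G b c₁ (inj₂ (BipGraph.endB G e)))
mainTheorem14 G _ b c₁ c₂ c₁≁c₂ hooked₁ hooked₂ e =
  hooked-components-nonadjacent G b c₁≁c₂ hooked₁ hooked₂ e ,
  hooked-components-nonadjacent G b (c₁≁c₂ ∘ FlexReach-sym G b) hooked₂ hooked₁ e
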